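{- Let $K$ be a field and let $f(Y)\in K[Y]$ be a nonconstant monic polynomial of degree greater than $2$. Suppose that for every root $\alpha$ of $f(Y)$ in a splitting field of $f$ over $K$, the twisted $Y$-derivative of $f$ at $\alpha$ is irreducible in $K(\alpha)[Y]$. Then $f(Y)$ has no multiple roots in any overfield of $K$.
   Context: For a polynomial $\theta(Y)$ with coefficients in a field $L$ and an element $\beta\in L$, the twisted $Y$-derivative of $\theta$ at $\beta$ is the polynomial $(\theta(Y+\beta)-\theta(\beta))/Y\in L[Y]$. -}

module Defs where

open import Level using (Level; _⊔_; suc)
open import Algebra.Bundles using (CommutativeRing)
open import Data.Nat using (ℕ; zero; suc)
open import Data.List using (List; []; _∷_; map; _++_)
open import Data.List.Relation.Unary.All using (All)
open import Data.Vec.Functional using (Vector)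
open import Data.Fin using (Fin)
open import Data.Product using (Σ; ∃; _×_; _,_)
open import Data.Sum using (_⊎_)
open import Relation.Nullary using (¬_)

record Field (c ℓ : Level) : Set (Level.suc (c ⊔ ℓ)) where
  field
    commutativeRing : CommutativeRing c ℓ
  open CommutativeRing commutativeRing public
  field
    0≉1     : ¬ (0# ≈ 1#)
    inverse : ∀ x → ¬ (x ≈ 0#) → ∃ λ y → x * y ≈ 1#

-- Polynomials over a commutative ring, as coefficient lists
-- (constant coefficient first).  Equality is coefficientwise, with
-- coefficients beyond the end of the list being 0.

module Poly {c ℓ} (R : CommutativeRing c ℓ) where
  open CommutativeRing R

  Pol : Set c
  Pol = List Carrier

  coeff : Pol → ℕ → Carrier
  coeff []      _       = 0#
  coeff (a ∷ p) zero    = a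
  coeff (a ∷ p) (suc i) = coeff p i

  infix 4 _≈ₚ_
  _≈ₚ_ : Pol → Pol → Set ℓ
  p ≈ₚ q = ∀ i → coeff p i ≈ coeff q i

  infixl 6 _+ₚ_
  _+ₚ_ : Pol → Pol → Pol
  []      +ₚ q       = q
  (a ∷ p) +ₚ []      = a ∷ p
  (a ∷ p) +ₚ (b ∷ q) = (a + b) ∷ (p +ₚ q)

  -ₚ_ : Pol → Pol
  -ₚ p = map (-_) p

  _·ₚ_ : Carrier → Pol → Pol
  a ·ₚ p = map (a *_) p

  infixl 7 _*ₚ_
  _*ₚ_ : Pol → Pol → Pol
  []      *ₚ q = []
  (a ∷ p) *ₚ q = (a ·ₚ q) +ₚ (0# ∷ (p *ₚ q))

  const : Carrier → Pol
  const a = a ∷ []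

  Y+ : Carrier → Pol
  Y+ b = b ∷ 1# ∷ []

  Y- : Carrier → Pol
  Y- b = (- b) ∷ 1# ∷ []

  eval : Pol → Carrier → Carrier
  eval []      x = 0#
  eval (a ∷ p) x = a + x * eval p x

  shift : Pol → Carrier → Pol
  shift []      β = []
  shift (a ∷ p) β = const a +ₚ (Y+ β *ₚ shift p β)

  -- The twisted Y-derivative (θ(Y+β) - θ(β)) / Y.  The constant
  -- coefficient of θ(Y+β) is θ(β), so subtracting it and dividing by Y
  -- amounts to dropping the constant coefficient of θ(Y+β).
  twistedDeriv : Pol → Carrier → Pol
  twistedDeriv θ β with shift θ β
  ... | []      = []
  ... | _ ∷ ps  = ps

  prodLin : (n : ℕ) → (Fin n → Carrier) → Pol
  prodLin zero    r = const 1#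
  prodLin (suc n) r = Y- (r Data.Fin.zero) *ₚ prodLin n (λ i → r (Data.Fin.suc i))

  -- Polynomial ring F[Y] for a subring/subfield F given by a predicate:
  -- coefficients all lie in F.
  InSub : ∀ {p} → (Carrier → Set p) → Pol → Set (c ⊔ p)
  InSub F q = All F q

  IsUnitIn : ∀ {p} → (Carrier → Set p) → Pol → Set (c ⊔ ℓ ⊔ p)
  IsUnitIn F a = Σ Pol λ b → InSub F b × (a *ₚ b ≈ₚ const 1#)

  IrreducibleIn : ∀ {p} → (Carrier → Set p) → Pol → Set (c ⊔ ℓ ⊔ p)
  IrreducibleIn F g =
    InSub F g ×
    ¬ IsUnitIn F g ×
    (∀ a b → InSub F a → InSub F b → g ≈ₚ a *ₚ b → IsUnitIn F a ⊎ IsUnitIn F b)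

-- Field extensions: ring homomorphisms K → L between fields
-- (automatically injective).

record Embedding {c ℓ c' ℓ'} (K : Field c ℓ) (L : Field c' ℓ')
       : Set (c ⊔ ℓ ⊔ c' ⊔ ℓ') where
  private
    module K = Field K
    module L = Field L
  field
    ⟦_⟧   : K.Carrier → L.Carrier
    cong  : ∀ {x y} → x K.≈ y → ⟦ x ⟧ L.≈ ⟦ y ⟧
    +-hom : ∀ x y → ⟦ x K.+ y ⟧ L.≈ ⟦ x ⟧ L.+ ⟦ y ⟧
    *-hom : ∀ x y → ⟦ x K.* y ⟧ L.≈ ⟦ x ⟧ L.* ⟦ y ⟧
    0-hom : ⟦ K.0# ⟧ L.≈ L.0#
    1-hom : ⟦ K.1# ⟧ L.≈ L.1#

module _ {c ℓ c' ℓ'} {K : Field c ℓ} {L : Field c' ℓ'} (ι : Embedding K L) where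
  private module L = Field L
  open Embedding ι

  data Adjoin {p} (S : L.Carrier → Set p) : L.Carrier → Set (c ⊔ ℓ' ⊔ c' ⊔ p) where
    base : ∀ k → Adjoin S ⟦ k ⟧
    gen  : ∀ {x} → S x → Adjoin S x
    add  : ∀ {x y} → Adjoin S x → Adjoin S y → Adjoin S (x L.+ y)
    neg  : ∀ {x} → Adjoin S x → Adjoin S (L.- x)
    mul  : ∀ {x y} → Adjoin S x → Adjoin S y → Adjoin S (x L.* y)
    inv  : ∀ {x y} → Adjoin S x → x L.* y L.≈ L.1# → Adjoin S y
    resp : ∀ {x y} → Adjoin S x → x L.≈ y → Adjoin S y

monic : ∀ {c ℓ} (K : Field c ℓ) (n : ℕ) → (Fin n → Field.Carrier K) → List (Field.Carrier K)
monic K zero    a = Field.1# K ∷ []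
monic K (suc n) a = a Data.Fin.zero ∷ monic K n (λ i → a (Data.Fin.suc i))

mapPol : ∀ {c ℓ c' ℓ'} {K : Field c ℓ} {L : Field c' ℓ'} →
         Embedding K L → List (Field.Carrier K) → List (Field.Carrier L)
mapPol ι = map (Embedding.⟦_⟧ ι)

record IsSplittingField {c ℓ c' ℓ'} (K : Field c ℓ) (L : Field c' ℓ')
       (ι : Embedding K L) (f : List (Field.Carrier K)) (n : ℕ)
       : Set (c ⊔ ℓ ⊔ c' ⊔ ℓ') where
  private module L = Field L
  open Poly L.commutativeRing
  field
    roots     : Fin n → L.Carrier
    splits    : mapPol ι f ≈ₚ prodLin n roots
    generated : ∀ x → Adjoin ι (λ y → ∃ λ i → y L.≈ roots i) x

HasMultipleRoot : ∀ {c ℓ c' ℓ'} {K : Field c ℓ} (L : Field c' ℓ') →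
                  Embedding K L → List (Field.Carrier K) → Set (c' ⊔ ℓ')
HasMultipleRoot L ι f =
  ∃ λ β → ∃ λ q → mapPol ι f ≈ₚ (Y- β *ₚ Y- β) *ₚ q
  where open Poly (Field.commutativeRing L)

{-# OPTIONS --safe #-}

-- If f had a multiple root β in an extension M, then β would be a common root of f and f′.
-- Running the Euclidean algorithm on f and f′ in K[Y] inside the ideal of polynomials vanishing
-- at β yields a monic common divisor d of f and f′ with d(β) = 0, so d is not constant. As d
-- divides f = ∏ (Y - rᵢ) over the splitting field L, some rᵢ is a root of d and hence of f′.
-- But f(Y + rᵢ) = f(rᵢ) + f′(rᵢ) Y + …, so then the twisted derivative at rᵢ has zero constant
-- term: it is Y times a monic polynomial of degree deg f - 2 ≥ 1 over K(rᵢ), hence reducible.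
--
-- Equality in a field is not assumed decidable, so case distinctions on whether a coefficient
-- vanishes are made under a double negation; this is harmless as the theorem is a negation.

module Submission where

open import Level using (_⊔_)
open import Algebra.Bundles using (CommutativeRing; CommutativeMonoid; Semiring)
open import Algebra.Structures using (IsCommutativeMonoid)
open import Algebra.Morphism.Structures using (module SemiringMorphisms)
open SemiringMorphisms using (IsSemiringHomomorphism)
open import Data.Nat as ℕ using (ℕ; zero; suc; _>_; _<_; _≤_; z≤n; s≤s)
import Data.Nat.Properties as ℕ
open import Data.Fin as Fin using (Fin)
open import Data.List using ([]; _∷_; map; length; drop)
open import Data.List.Relation.Unary.All using ([]; _∷_)
import Data.List.Relation.Unary.All as All
import Data.List.Relation.Unary.All.Properties as All
open import Data.Maybe using (nothing)
open import Function using (_∘_)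
open import Data.Product using (∃; _×_; _,_; proj₁; proj₂)
open import Data.Sum using (_⊎_; inj₁; inj₂)
open import Data.Empty using (⊥)
open import Relation.Nullary using (¬_; yes; no; ¬¬-excluded-middle; contradiction)
import Relation.Binary.PropositionalEquality as ≡
open ≡ using (_≡_)
import Relation.Binary.Reasoning.Setoid as SetoidReasoning
import Algebra.Solver.Ring.NaturalCoefficients as NaturalCoefficients
import Algebra.Properties.Ring as RingProperties
import Algebra.Properties.CommutativeSemigroup as CommutativeSemigroupProperties
import Algebra.Properties.Semiring.Divisibility as SemiringDivisibility

open import Defs

module CommutativeSemiringSolver {c ℓ} (R : CommutativeRing c ℓ) =
  NaturalCoefficients (CommutativeRing.commutativeSemiring R) (λ _ _ → nothing)

module Polynomials {c ℓ} (R : CommutativeRing c ℓ) where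
  open CommutativeRing R hiding (zero)
  open RingProperties ring using (-0#≈0#)
  open Poly R public
  private module CoeffSolver = CommutativeSemiringSolver R

  -- A record rather than _≈ₚ_ itself, so that the polynomials are
  -- inferable from a proof of their equality.
  infix 4 _≋_
  record _≋_ (p q : Pol) : Set ℓ where
    constructor mk≋
    field at : p ≈ₚ q
  open _≋_ public

  ≋-refl : ∀ {p} → p ≋ p
  ≋-refl = mk≋ λ _ → refl

  ≋-sym : ∀ {p q} → p ≋ q → q ≋ p
  ≋-sym e = mk≋ λ i → sym (at e i)

  ≋-trans : ∀ {p q r} → p ≋ q → q ≋ r → p ≋ r
  ≋-trans e f = mk≋ λ i → trans (at e i) (at f i)

  ∷-cong : ∀ {a b p q} → a ≈ b → p ≋ q → (a ∷ p) ≋ (b ∷ q)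
  ∷-cong a≈b p≋q = mk≋ λ { zero → a≈b ; (suc i) → at p≋q i }

  ∷-injectiveʳ : ∀ {a b p q} → (a ∷ p) ≋ (b ∷ q) → p ≋ q
  ∷-injectiveʳ e = mk≋ λ i → at e (suc i)

  ∷≋[]⇒≋[] : ∀ {a p} → (a ∷ p) ≋ [] → p ≋ []
  ∷≋[]⇒≋[] e = mk≋ λ i → at e (suc i)

  0∷[]≋[] : (0# ∷ []) ≋ []
  0∷[]≋[] = mk≋ λ { zero → refl ; (suc i) → refl }

  coeff-+ₚ : ∀ p q i → coeff (p +ₚ q) i ≈ coeff p i + coeff q i
  coeff-+ₚ []      q       i       = sym (+-identityˡ _)
  coeff-+ₚ (a ∷ p) []      i       = sym (+-identityʳ _)
  coeff-+ₚ (a ∷ p) (b ∷ q) zero    = refl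
  coeff-+ₚ (a ∷ p) (b ∷ q) (suc i) = coeff-+ₚ p q i

  coeff-·ₚ : ∀ a p i → coeff (a ·ₚ p) i ≈ a * coeff p i
  coeff-·ₚ a []      i       = sym (zeroʳ a)
  coeff-·ₚ a (b ∷ p) zero    = refl
  coeff-·ₚ a (b ∷ p) (suc i) = coeff-·ₚ a p i

  coeff--ₚ : ∀ p i → coeff (-ₚ p) i ≈ - coeff p i
  coeff--ₚ []      i       = sym -0#≈0#
  coeff--ₚ (b ∷ p) zero    = refl
  coeff--ₚ (b ∷ p) (suc i) = coeff--ₚ p i

  coeff-∷*ₚ : ∀ a p q i → coeff ((a ∷ p) *ₚ q) i ≈ a * coeff q i + coeff (0# ∷ p *ₚ q) i
  coeff-∷*ₚ a p q i = trans (coeff-+ₚ (a ·ₚ q) (0# ∷ p *ₚ q) i) (+-congʳ (coeff-·ₚ a q i))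

  +ₚ-cong : ∀ {p p′ q q′} → p ≋ p′ → q ≋ q′ → (p +ₚ q) ≋ (p′ +ₚ q′)
  +ₚ-cong {p} {p′} {q} {q′} e f = mk≋ λ i →
    trans (coeff-+ₚ p q i) (trans (+-cong (at e i) (at f i)) (sym (coeff-+ₚ p′ q′ i)))

  +ₚ-congˡ : ∀ p {q q′} → q ≋ q′ → (p +ₚ q) ≋ (p +ₚ q′)
  +ₚ-congˡ p = +ₚ-cong (≋-refl {p})

  +ₚ-congʳ : ∀ q {p p′} → p ≋ p′ → (p +ₚ q) ≋ (p′ +ₚ q)
  +ₚ-congʳ q e = +ₚ-cong e (≋-refl {q})

  ·ₚ-cong : ∀ {a b p q} → a ≈ b → p ≋ q → (a ·ₚ p) ≋ (b ·ₚ q)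
  ·ₚ-cong {a} {b} {p} {q} e f = mk≋ λ i →
    trans (coeff-·ₚ a p i) (trans (*-cong e (at f i)) (sym (coeff-·ₚ b q i)))

  -ₚ-cong : ∀ {p q} → p ≋ q → (-ₚ p) ≋ (-ₚ q)
  -ₚ-cong {p} {q} f = mk≋ λ i →
    trans (coeff--ₚ p i) (trans (-‿cong (at f i)) (sym (coeff--ₚ q i)))

  0·ₚ≋[] : ∀ q → (0# ·ₚ q) ≋ []
  0·ₚ≋[] q = mk≋ λ i → trans (coeff-·ₚ 0# q i) (zeroˡ _)

  ≋[]⇒*ₚ≋[] : ∀ {p} q → p ≋ [] → (p *ₚ q) ≋ []
  ≋[]⇒*ₚ≋[] {[]}    q e = ≋-refl
  ≋[]⇒*ₚ≋[] {a ∷ p} q e = ≋-trans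
    (+ₚ-cong (·ₚ-cong (at e zero) ≋-refl) (∷-cong refl (≋[]⇒*ₚ≋[] q (∷≋[]⇒≋[] e))))
    (+ₚ-cong (0·ₚ≋[] q) 0∷[]≋[])

  *ₚ-congʳ : ∀ {p p′} q → p ≋ p′ → (p *ₚ q) ≋ (p′ *ₚ q)
  *ₚ-congʳ {[]}    {p′}     q e = ≋-sym (≋[]⇒*ₚ≋[] q (≋-sym e))
  *ₚ-congʳ {a ∷ p} {[]}     q e = ≋[]⇒*ₚ≋[] q e
  *ₚ-congʳ {a ∷ p} {b ∷ p′} q e =
    +ₚ-cong (·ₚ-cong (at e zero) ≋-refl) (∷-cong refl (*ₚ-congʳ q (∷-injectiveʳ e)))

  *ₚ-congˡ : ∀ p {q q′} → q ≋ q′ → (p *ₚ q) ≋ (p *ₚ q′)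
  *ₚ-congˡ []      e = ≋-refl
  *ₚ-congˡ (a ∷ p) e = +ₚ-cong (·ₚ-cong refl e) (∷-cong refl (*ₚ-congˡ p e))

  *ₚ-cong : ∀ {p p′ q q′} → p ≋ p′ → q ≋ q′ → (p *ₚ q) ≋ (p′ *ₚ q′)
  *ₚ-cong {p′ = p′} {q} e f = ≋-trans (*ₚ-congʳ q e) (*ₚ-congˡ p′ f)

  +ₚ-assoc : ∀ p q r → ((p +ₚ q) +ₚ r) ≋ (p +ₚ (q +ₚ r))
  +ₚ-assoc p q r = mk≋ λ i → begin
    coeff ((p +ₚ q) +ₚ r) i             ≈⟨ coeff-+ₚ (p +ₚ q) r i ⟩
    coeff (p +ₚ q) i + coeff r i        ≈⟨ +-congʳ (coeff-+ₚ p q i) ⟩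
    (coeff p i + coeff q i) + coeff r i ≈⟨ +-assoc _ _ _ ⟩
    coeff p i + (coeff q i + coeff r i) ≈⟨ +-congˡ (coeff-+ₚ q r i) ⟨
    coeff p i + coeff (q +ₚ r) i        ≈⟨ coeff-+ₚ p (q +ₚ r) i ⟨
    coeff (p +ₚ (q +ₚ r)) i             ∎
    where open SetoidReasoning setoid

  +ₚ-comm : ∀ p q → (p +ₚ q) ≋ (q +ₚ p)
  +ₚ-comm p q = mk≋ λ i →
    trans (coeff-+ₚ p q i) (trans (+-comm _ _) (sym (coeff-+ₚ q p i)))

  +ₚ-identityʳ : ∀ p → (p +ₚ []) ≋ p
  +ₚ-identityʳ p = mk≋ λ i → trans (coeff-+ₚ p [] i) (+-identityʳ _)

  -ₚ-inverseˡ : ∀ p → ((-ₚ p) +ₚ p) ≋ []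
  -ₚ-inverseˡ p = mk≋ λ i →
    trans (coeff-+ₚ (-ₚ p) p i) (trans (+-congʳ (coeff--ₚ p i)) (-‿inverseˡ _))

  -ₚ-inverseʳ : ∀ p → (p +ₚ (-ₚ p)) ≋ []
  -ₚ-inverseʳ p = ≋-trans (+ₚ-comm p (-ₚ p)) (-ₚ-inverseˡ p)

  +ₚ-isCommutativeMonoid : IsCommutativeMonoid _≋_ _+ₚ_ []
  +ₚ-isCommutativeMonoid = record
    { isMonoid = record
      { isSemigroup = record
        { isMagma = record
          { isEquivalence = record { refl = ≋-refl ; sym = ≋-sym ; trans = ≋-trans }
          ; ∙-cong        = +ₚ-cong }
        ; assoc = +ₚ-assoc }
      ; identity = (λ _ → ≋-refl) , +ₚ-identityʳ }
    ; comm = +ₚ-comm }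

  +ₚ-commutativeMonoid : CommutativeMonoid c ℓ
  +ₚ-commutativeMonoid = record { isCommutativeMonoid = +ₚ-isCommutativeMonoid }

  open CommutativeSemigroupProperties (CommutativeMonoid.commutativeSemigroup +ₚ-commutativeMonoid)
    using (interchange; x∙yz≈y∙xz)

  0∷-+ₚ : ∀ p q → (0# ∷ (p +ₚ q)) ≋ ((0# ∷ p) +ₚ (0# ∷ q))
  0∷-+ₚ p q = ∷-cong (sym (+-identityʳ 0#)) ≋-refl

  ·ₚ-distribʳ : ∀ a b p → ((a + b) ·ₚ p) ≋ ((a ·ₚ p) +ₚ (b ·ₚ p))
  ·ₚ-distribʳ a b p = mk≋ λ i → trans (coeff-·ₚ (a + b) p i) (trans (distribʳ _ a b)
    (sym (trans (coeff-+ₚ (a ·ₚ p) (b ·ₚ p) i) (+-cong (coeff-·ₚ a p i) (coeff-·ₚ b p i)))))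

  ·ₚ-distribˡ : ∀ a p q → (a ·ₚ (p +ₚ q)) ≋ ((a ·ₚ p) +ₚ (a ·ₚ q))
  ·ₚ-distribˡ a p q = mk≋ λ i → trans (coeff-·ₚ a (p +ₚ q) i) (trans (*-congˡ (coeff-+ₚ p q i))
    (trans (distribˡ a _ _)
           (sym (trans (coeff-+ₚ (a ·ₚ p) (a ·ₚ q) i) (+-cong (coeff-·ₚ a p i) (coeff-·ₚ a q i))))))

  ·ₚ-assoc : ∀ a b p → (a ·ₚ (b ·ₚ p)) ≋ ((a * b) ·ₚ p)
  ·ₚ-assoc a b p = mk≋ λ i → trans (coeff-·ₚ a (b ·ₚ p) i) (trans (*-congˡ (coeff-·ₚ b p i))
    (trans (sym (*-assoc a b _)) (sym (coeff-·ₚ (a * b) p i))))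

  *ₚ-zeroʳ : ∀ p → (p *ₚ []) ≋ []
  *ₚ-zeroʳ []      = ≋-refl
  *ₚ-zeroʳ (a ∷ p) = ≋-trans (∷-cong refl (*ₚ-zeroʳ p)) 0∷[]≋[]

  *ₚ-distribʳ : ∀ r p q → ((p +ₚ q) *ₚ r) ≋ ((p *ₚ r) +ₚ (q *ₚ r))
  *ₚ-distribʳ r []      q       = ≋-refl
  *ₚ-distribʳ r (a ∷ p) []      = ≋-sym (+ₚ-identityʳ _)
  *ₚ-distribʳ r (a ∷ p) (b ∷ q) = ≋-trans
    (+ₚ-cong (·ₚ-distribʳ a b r) (≋-trans (∷-cong refl (*ₚ-distribʳ r p q)) (0∷-+ₚ (p *ₚ r) (q *ₚ r))))
    (interchange (a ·ₚ r) (b ·ₚ r) (0# ∷ p *ₚ r) (0# ∷ q *ₚ r))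

  *ₚ-∷ : ∀ p b q → (p *ₚ (b ∷ q)) ≋ ((b ·ₚ p) +ₚ (0# ∷ p *ₚ q))
  *ₚ-∷ []      b q = ≋-sym 0∷[]≋[]
  *ₚ-∷ (a ∷ p) b q = ∷-cong (+-congʳ (*-comm a b)) (≋-trans
    (+ₚ-cong (≋-refl {a ·ₚ q}) (*ₚ-∷ p b q))
    (x∙yz≈y∙xz (a ·ₚ q) (b ·ₚ p) (0# ∷ p *ₚ q)))

  *ₚ-comm : ∀ p q → (p *ₚ q) ≋ (q *ₚ p)
  *ₚ-comm []      q = ≋-sym (*ₚ-zeroʳ q)
  *ₚ-comm (a ∷ p) q = ≋-trans (+ₚ-cong ≋-refl (∷-cong refl (*ₚ-comm p q))) (≋-sym (*ₚ-∷ q a p))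

  *ₚ-distribˡ : ∀ p q r → (p *ₚ (q +ₚ r)) ≋ ((p *ₚ q) +ₚ (p *ₚ r))
  *ₚ-distribˡ p q r = ≋-trans (*ₚ-comm p (q +ₚ r))
    (≋-trans (*ₚ-distribʳ p q r) (+ₚ-cong (*ₚ-comm q p) (*ₚ-comm r p)))

  ·ₚ-*ₚ : ∀ a q r → ((a ·ₚ q) *ₚ r) ≋ (a ·ₚ (q *ₚ r))
  ·ₚ-*ₚ a []      r = ≋-refl
  ·ₚ-*ₚ a (b ∷ q) r = ≋-sym (≋-trans (·ₚ-distribˡ a (b ·ₚ r) (0# ∷ q *ₚ r))
    (+ₚ-cong (·ₚ-assoc a b r) (∷-cong (zeroʳ a) (≋-sym (·ₚ-*ₚ a q r)))))

  0∷-*ₚ : ∀ p q → ((0# ∷ p) *ₚ q) ≋ (0# ∷ p *ₚ q)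
  0∷-*ₚ p q = +ₚ-cong (0·ₚ≋[] q) ≋-refl

  *ₚ-assoc : ∀ p q r → ((p *ₚ q) *ₚ r) ≋ (p *ₚ (q *ₚ r))
  *ₚ-assoc []      q r = ≋-refl
  *ₚ-assoc (a ∷ p) q r = ≋-trans (*ₚ-distribʳ r (a ·ₚ q) (0# ∷ p *ₚ q))
    (+ₚ-cong (·ₚ-*ₚ a q r) (≋-trans (0∷-*ₚ (p *ₚ q) r) (∷-cong refl (*ₚ-assoc p q r))))

  1ₚ : Pol
  1ₚ = const 1#

  *ₚ-identityˡ : ∀ p → (1ₚ *ₚ p) ≋ p
  *ₚ-identityˡ p = mk≋ λ i → trans (coeff-+ₚ (1# ·ₚ p) (0# ∷ []) i)
    (trans (+-cong (coeff-·ₚ 1# p i) (at 0∷[]≋[] i)) (trans (+-identityʳ _) (*-identityˡ _)))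

  *ₚ-identityʳ : ∀ p → (p *ₚ 1ₚ) ≋ p
  *ₚ-identityʳ p = ≋-trans (*ₚ-comm p 1ₚ) (*ₚ-identityˡ p)

  polyRing : CommutativeRing c ℓ
  polyRing = record
    { Carrier = Pol ; _≈_ = _≋_ ; _+_ = _+ₚ_ ; _*_ = _*ₚ_ ; -_ = -ₚ_ ; 0# = [] ; 1# = 1ₚ
    ; isCommutativeRing = record
      { isRing = record
        { +-isAbelianGroup = record
          { isGroup = record
            { isMonoid = IsCommutativeMonoid.isMonoid +ₚ-isCommutativeMonoid
            ; inverse  = -ₚ-inverseˡ , -ₚ-inverseʳ
            ; ⁻¹-cong  = -ₚ-cong }
          ; comm = +ₚ-comm }
        ; *-cong     = *ₚ-cong
        ; *-assoc    = *ₚ-assoc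
        ; *-identity = *ₚ-identityˡ , *ₚ-identityʳ
        ; distrib    = *ₚ-distribˡ , *ₚ-distribʳ }
      ; *-comm = *ₚ-comm } }

  module ≋-Reasoning = SetoidReasoning (CommutativeRing.setoid polyRing)
  module PolySolver = CommutativeSemiringSolver polyRing

  Yₚ : Pol
  Yₚ = 0# ∷ 1# ∷ []

  Yₚ*ₚ : ∀ p → (Yₚ *ₚ p) ≋ (0# ∷ p)
  Yₚ*ₚ p = +ₚ-cong (0·ₚ≋[] p) (∷-cong refl (*ₚ-identityˡ p))

  ∷≋const+Yₚ*ₚ : ∀ a p → (a ∷ p) ≋ (const a +ₚ (Yₚ *ₚ p))
  ∷≋const+Yₚ*ₚ a p = ≋-sym (≋-trans (+ₚ-congˡ (const a) (Yₚ*ₚ p)) (∷-cong (+-identityʳ a) ≋-refl))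

  const-* : ∀ a b → const (a * b) ≋ (const a *ₚ const b)
  const-* a b = ∷-cong (sym (+-identityʳ _)) ≋-refl

  eval-≋[] : ∀ {p} x → p ≋ [] → eval p x ≈ 0#
  eval-≋[] {[]}    x e = refl
  eval-≋[] {a ∷ p} x e =
    trans (+-cong (at e 0) (trans (*-congˡ (eval-≋[] x (∷≋[]⇒≋[] e))) (zeroʳ x))) (+-identityʳ _)

  eval-cong : ∀ {p q} x → p ≋ q → eval p x ≈ eval q x
  eval-cong {[]}    {q}     x e = sym (eval-≋[] x (≋-sym e))
  eval-cong {a ∷ p} {[]}    x e = eval-≋[] x e
  eval-cong {a ∷ p} {b ∷ q} x e = +-cong (at e 0) (*-congˡ (eval-cong x (∷-injectiveʳ e)))

  eval-+ₚ : ∀ p q x → eval (p +ₚ q) x ≈ eval p x + eval q x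
  eval-+ₚ []      q       x = sym (+-identityˡ _)
  eval-+ₚ (a ∷ p) []      x = sym (+-identityʳ _)
  eval-+ₚ (a ∷ p) (b ∷ q) x = begin
    (a + b) + x * eval (p +ₚ q) x
      ≈⟨ +-congˡ (*-congˡ (eval-+ₚ p q x)) ⟩
    (a + b) + x * (eval p x + eval q x)
      ≈⟨ solve 5 (λ a b x u v → ((a :+ b) :+ x :* (u :+ v)) := ((a :+ x :* u) :+ (b :+ x :* v))) refl a b x _ _ ⟩
    (a + x * eval p x) + (b + x * eval q x) ∎
    where
    open SetoidReasoning setoid
    open CoeffSolver

  eval-·ₚ : ∀ a p x → eval (a ·ₚ p) x ≈ a * eval p x
  eval-·ₚ a []      x = sym (zeroʳ a)
  eval-·ₚ a (b ∷ p) x = trans (+-congˡ (*-congˡ (eval-·ₚ a p x)))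
    (solve 4 (λ a b x e → (a :* b :+ x :* (a :* e)) := (a :* (b :+ x :* e))) refl a b x (eval p x))
    where open CoeffSolver

  eval-*ₚ : ∀ p q x → eval (p *ₚ q) x ≈ eval p x * eval q x
  eval-*ₚ []      q x = sym (zeroˡ _)
  eval-*ₚ (a ∷ p) q x = begin
    eval ((a ·ₚ q) +ₚ (0# ∷ p *ₚ q)) x
      ≈⟨ eval-+ₚ (a ·ₚ q) (0# ∷ p *ₚ q) x ⟩
    eval (a ·ₚ q) x + (0# + x * eval (p *ₚ q) x)
      ≈⟨ +-cong (eval-·ₚ a q x) (trans (+-identityˡ _) (*-congˡ (eval-*ₚ p q x))) ⟩
    a * eval q x + x * (eval p x * eval q x)
      ≈⟨ solve 4 (λ a x u v → (a :* v :+ x :* (u :* v)) := ((a :+ x :* u) :* v)) refl a x (eval p x) (eval q x) ⟩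
    (a + x * eval p x) * eval q x ∎
    where
    open SetoidReasoning setoid
    open CoeffSolver

  eval-const : ∀ a x → eval (const a) x ≈ a
  eval-const a x = trans (+-congˡ (zeroʳ x)) (+-identityʳ a)

  eval-Y-[self] : ∀ b → eval (Y- b) b ≈ 0#
  eval-Y-[self] b = trans (+-congˡ (trans (*-congˡ (eval-const 1# b)) (*-identityʳ b))) (-‿inverseˡ b)

  eval-Y-*ₚ[self] : ∀ b p → eval (Y- b *ₚ p) b ≈ 0#
  eval-Y-*ₚ[self] b p = trans (eval-*ₚ (Y- b) p b) (trans (*-congʳ (eval-Y-[self] b)) (zeroˡ _))

  eval-prodLin-root : ∀ n r i → eval (prodLin n r) (r i) ≈ 0#
  eval-prodLin-root (suc n) r Fin.zero    = eval-Y-*ₚ[self] (r Fin.zero) (prodLin n (r ∘ Fin.suc))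
  eval-prodLin-root (suc n) r (Fin.suc i) =
    trans (eval-*ₚ (Y- (r Fin.zero)) (prodLin n (r ∘ Fin.suc)) (r (Fin.suc i)))
          (trans (*-congˡ (eval-prodLin-root n (r ∘ Fin.suc) i)) (zeroʳ _))

  -- Degree bounds and division by monic polynomials

  record Deg< (p : Pol) (k : ℕ) : Set ℓ where
    constructor mkDeg<
    field vanish : ∀ i → k ≤ i → coeff p i ≈ 0#
  open Deg< public

  Monic : Pol → ℕ → Set ℓ
  Monic p e = coeff p e ≈ 1# × Deg< p (suc e)

  Deg<-length : ∀ p → Deg< p (length p)
  Deg<-length p = mkDeg< (go p)
    where
    go : ∀ p i → length p ≤ i → coeff p i ≈ 0#
    go []      i       _        = refl
    go (a ∷ p) (suc i) (s≤s le) = go p i le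

  Deg<0⇒≋[] : ∀ {p} → Deg< p 0 → p ≋ []
  Deg<0⇒≋[] d = mk≋ λ i → vanish d i z≤n

  Deg<-∷ : ∀ {a p k} → Deg< (a ∷ p) (suc k) → Deg< p k
  Deg<-∷ d = mkDeg< λ i le → vanish d (suc i) (s≤s le)

  Deg<-shrink : ∀ {p k} → Deg< p (suc k) → coeff p k ≈ 0# → Deg< p k
  Deg<-shrink {p} {k} d top = mkDeg< go
    where
    go : ∀ i → k ≤ i → coeff p i ≈ 0#
    go i le with ℕ.m≤n⇒m<n∨m≡n le
    ... | inj₁ lt     = vanish d i lt
    ... | inj₂ ≡.refl = top

  Deg<1⇒*ₚ≋·ₚ : ∀ {a p} q → Deg< (a ∷ p) 1 → ((a ∷ p) *ₚ q) ≋ (a ·ₚ q)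
  Deg<1⇒*ₚ≋·ₚ {a} {p} q d = ≋-trans
    (+ₚ-congˡ (a ·ₚ q) (≋-trans (∷-cong refl (≋[]⇒*ₚ≋[] q (Deg<0⇒≋[] (Deg<-∷ d)))) 0∷[]≋[]))
    (+ₚ-identityʳ (a ·ₚ q))

  Deg<-*ₚ : ∀ {p q k l} → Deg< p (suc k) → Deg< q (suc l) → Deg< (p *ₚ q) (suc (k ℕ.+ l))
  Deg<-*ₚ {p} {q} {k} {l} dp dq = mkDeg< (go p k dp)
    where
    go : ∀ p k → Deg< p (suc k) → ∀ i → suc (k ℕ.+ l) ≤ i → coeff (p *ₚ q) i ≈ 0#
    go []      k       dp i       _        = refl
    go (a ∷ p) zero    dp i       le       = trans (at (Deg<1⇒*ₚ≋·ₚ q dp) i)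
      (trans (coeff-·ₚ a q i) (trans (*-congˡ (vanish dq i le)) (zeroʳ a)))
    go (a ∷ p) (suc k) dp (suc i) (s≤s le) = trans (coeff-∷*ₚ a p q (suc i))
      (trans (+-cong (trans (*-congˡ (vanish dq (suc i) (s≤s (ℕ.≤-trans (ℕ.m≤n+m l k) (ℕ.<⇒≤ le)))))
                            (zeroʳ a))
                     (go p k (Deg<-∷ dp) i le))
             (+-identityʳ 0#))

  coeff-*ₚ-leading : ∀ {p q} k l → Deg< p (suc k) → Deg< q (suc l) →
                     coeff (p *ₚ q) (k ℕ.+ l) ≈ coeff p k * coeff q l
  coeff-*ₚ-leading {[]}        k       l dp dq = sym (zeroˡ _)
  coeff-*ₚ-leading {a ∷ p} {q} zero    l dp dq = trans (at (Deg<1⇒*ₚ≋·ₚ q dp) l) (coeff-·ₚ a q l)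
  coeff-*ₚ-leading {a ∷ p} {q} (suc k) l dp dq = trans (coeff-∷*ₚ a p q (suc (k ℕ.+ l)))
    (trans (+-cong (trans (*-congˡ (vanish dq (suc (k ℕ.+ l)) (s≤s (ℕ.m≤n+m l k)))) (zeroʳ a))
                   (coeff-*ₚ-leading k l (Deg<-∷ dp) dq))
           (+-identityˡ _))

  Monic⇒¬unit : ¬ 0# ≈ 1# → ∀ {d e s} → Monic d (suc e) → ¬ (d *ₚ s) ≋ 1ₚ
  Monic⇒¬unit 0≉1 {d} {e} {s} (top , d<) ds≋1 = go (length s) (Deg<-length s)
    where
    go : ∀ l → Deg< s l → ⊥
    go zero    s<0 = 0≉1 (trans (sym (at (≋[]⇒*ₚ≋[] d (Deg<0⇒≋[] s<0)) 0))
                                (trans (at (*ₚ-comm s d) 0) (at ds≋1 0)))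
    go (suc l) s<  = go l (Deg<-shrink s< (begin
      coeff s l                      ≈⟨ *-identityˡ _ ⟨
      1# * coeff s l                 ≈⟨ *-congʳ top ⟨
      coeff d (suc e) * coeff s l    ≈⟨ coeff-*ₚ-leading (suc e) l d< s< ⟨
      coeff (d *ₚ s) (suc (e ℕ.+ l)) ≈⟨ at ds≋1 (suc (e ℕ.+ l)) ⟩
      0#                             ∎))
      where open SetoidReasoning setoid

  Monic⇒≋1ₚ : ∀ {d} → Monic d 0 → d ≋ 1ₚ
  Monic⇒≋1ₚ (top , d<1) = mk≋ λ { zero → top ; (suc i) → vanish d<1 (suc i) (s≤s z≤n) }

  monomial : ℕ → Carrier → Pol
  monomial zero    a = const a
  monomial (suc j) a = 0# ∷ monomial j a

  coeff-monomial : ∀ j a → coeff (monomial j a) j ≈ a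
  coeff-monomial zero    a = refl
  coeff-monomial (suc j) a = coeff-monomial j a

  Deg<-monomial : ∀ j a → Deg< (monomial j a) (suc j)
  Deg<-monomial j a = mkDeg< (go j)
    where
    go : ∀ j i → suc j ≤ i → coeff (monomial j a) i ≈ 0#
    go zero    (suc i) _        = refl
    go (suc j) (suc i) (s≤s le) = go j i le

  Deg<-cancel-leading : ∀ {p m k e} → Deg< p (suc k) → Monic m e → e ≤ k →
                        Deg< (p +ₚ -ₚ (monomial (k ℕ.∸ e) (coeff p k) *ₚ m)) k
  Deg<-cancel-leading {p} {m} {k} {e} dp (top , dm) e≤k = mkDeg< go
    where
    X = monomial (k ℕ.∸ e) (coeff p k) *ₚ m
    k∸e+e≡k : k ℕ.∸ e ℕ.+ e ≡ k
    k∸e+e≡k = ℕ.m∸n+n≡m e≤k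
    X<1+k : Deg< X (suc k)
    X<1+k = ≡.subst (λ n → Deg< X (suc n)) k∸e+e≡k (Deg<-*ₚ (Deg<-monomial (k ℕ.∸ e) (coeff p k)) dm)
    Xₖ≈pₖ : coeff X k ≈ coeff p k
    Xₖ≈pₖ = ≡.subst (λ n → coeff X n ≈ coeff p k) k∸e+e≡k
      (trans (coeff-*ₚ-leading (k ℕ.∸ e) e (Deg<-monomial _ _) dm)
             (trans (*-cong (coeff-monomial (k ℕ.∸ e) (coeff p k)) top) (*-identityʳ _)))
    go : ∀ i → k ≤ i → coeff (p +ₚ -ₚ X) i ≈ 0#
    go i le with ℕ.m≤n⇒m<n∨m≡n le
    ... | inj₁ k<i = trans (coeff-+ₚ p (-ₚ X) i)
      (trans (+-cong (vanish dp i k<i) (trans (coeff--ₚ X i) (trans (-‿cong (vanish X<1+k i k<i)) -0#≈0#)))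
             (+-identityˡ 0#))
    ... | inj₂ ≡.refl = trans (coeff-+ₚ p (-ₚ X) k)
      (trans (+-congˡ (trans (coeff--ₚ X k) (-‿cong Xₖ≈pₖ))) (-‿inverseʳ _))

  divide-by-monic : ∀ k {p m e} → Deg< p k → Monic m e →
                    ∃ λ w → ∃ λ r → p ≋ ((w *ₚ m) +ₚ r) × Deg< r e
  divide-by-monic k {p} {m} {e} dp monic-m with k ℕ.≤? e
  ... | yes k≤e = [] , p , ≋-refl , mkDeg< λ i le → vanish dp i (ℕ.≤-trans k≤e le)
  divide-by-monic zero    dp monic-m | no k≰e = contradiction z≤n k≰e
  divide-by-monic (suc k) {p} {m} {e} dp monic-m | no k≰e
    with divide-by-monic k (Deg<-cancel-leading dp monic-m e≤k) monic-m
    where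
    e≤k : e ≤ k
    e≤k = ℕ.≤-pred (ℕ.≰⇒> k≰e)
  ... | w , r , p-X≋ , dr = w +ₚ t , r , p≋ , dr
    where
    t = monomial (k ℕ.∸ e) (coeff p k)
    X = t *ₚ m
    p≋ : p ≋ (((w +ₚ t) *ₚ m) +ₚ r)
    p≋ = begin
      p                          ≈⟨ +ₚ-identityʳ p ⟨
      p +ₚ []                    ≈⟨ +ₚ-congˡ p (-ₚ-inverseˡ X) ⟨
      p +ₚ ((-ₚ X) +ₚ X)         ≈⟨ +ₚ-assoc p (-ₚ X) X ⟨
      (p +ₚ (-ₚ X)) +ₚ X         ≈⟨ +ₚ-congʳ X p-X≋ ⟩
      ((w *ₚ m) +ₚ r) +ₚ X       ≈⟨ solve 4 (λ W M R T → ((W :* M :+ R) :+ T :* M) := ((W :+ T) :* M :+ R))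
                                           ≋-refl w m r t ⟩
      ((w +ₚ t) *ₚ m) +ₚ r       ∎
      where
      open ≋-Reasoning
      open PolySolver

  -- Divisibility and ideals

  private module PolyRingProperties = RingProperties (CommutativeRing.ring polyRing)
  open SemiringDivisibility (CommutativeRing.semiring polyRing) public
    using (_∣_; _∥_; _,_; ∣ʳ-refl; ∣ʳ-trans; ∣ʳ-respʳ-≈; x∣ʳy⇒x∣ʳzy; xy≈z⇒y∣ʳz)

  ∣-+ₚ : ∀ {d p q} → d ∣ p → d ∣ q → d ∣ (p +ₚ q)
  ∣-+ₚ {d} (s , s*d≋p) (t , t*d≋q) = s +ₚ t , ≋-trans (*ₚ-distribʳ d s t) (+ₚ-cong s*d≋p t*d≋q)

  const-*ₚ : ∀ a p → (const a *ₚ p) ≋ (a ·ₚ p)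
  const-*ₚ a p = ≋-trans (+ₚ-congˡ (a ·ₚ p) 0∷[]≋[]) (+ₚ-identityʳ (a ·ₚ p))

  ∣-preserves-root : ∀ {d q x} → d ∣ q → eval d x ≈ 0# → eval q x ≈ 0#
  ∣-preserves-root {d} {q} {x} (s , s*d≋q) d[x]≈0 = trans (eval-cong x (≋-sym s*d≋q))
    (trans (eval-*ₚ s d x) (trans (*-congˡ d[x]≈0) (zeroʳ _)))

  ·ₚ-∥ : ∀ {a b} p → a * b ≈ 1# → (b ·ₚ p) ∥ p
  ·ₚ-∥ {a} {b} p ab≈1 = (const a , a·b·p≋p) , (const b , const-*ₚ b p)
    where
    a·b·p≋p : (const a *ₚ (b ·ₚ p)) ≋ p
    a·b·p≋p = begin
      const a *ₚ (b ·ₚ p) ≈⟨ const-*ₚ a (b ·ₚ p) ⟩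
      a ·ₚ (b ·ₚ p)       ≈⟨ ·ₚ-assoc a b p ⟩
      (a * b) ·ₚ p        ≈⟨ ·ₚ-cong ab≈1 ≋-refl ⟩
      1# ·ₚ p             ≈⟨ const-*ₚ 1# p ⟨
      1ₚ *ₚ p             ≈⟨ *ₚ-identityˡ p ⟩
      p                   ∎
      where open ≋-Reasoning

  remainder-theorem : ∀ p x → ∃ λ k → p ≋ ((Y- x *ₚ k) +ₚ const (eval p x))
  remainder-theorem []      x = [] , ≋-sym (≋-trans (+ₚ-congʳ (const 0#) (*ₚ-zeroʳ (Y- x))) 0∷[]≋[])
  remainder-theorem (a ∷ p) x with remainder-theorem p x
  ... | k , p≋ = eval p x ∷ k , (begin
    a ∷ p
      ≈⟨ ∷≋const+Yₚ*ₚ a p ⟩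
    A +ₚ (Yₚ *ₚ p)
      ≈⟨ +ₚ-congˡ A (*ₚ-cong Yₚ≋T+X p≋) ⟩
    A +ₚ ((T +ₚ X) *ₚ ((T *ₚ k) +ₚ C))
      ≈⟨ solve 5 (λ A T X K C → (A :+ (T :+ X) :* (T :* K :+ C)) := (T :* (C :+ (T :+ X) :* K) :+ (A :+ X :* C)))
               ≋-refl A T X k C ⟩
    (T *ₚ (C +ₚ ((T +ₚ X) *ₚ k))) +ₚ (A +ₚ (X *ₚ C))
      ≈⟨ +ₚ-cong (*ₚ-congˡ T (+ₚ-congˡ C (*ₚ-congʳ k (≋-sym Yₚ≋T+X))))
                 (+ₚ-congˡ A (≋-sym (const-* x _))) ⟩
    (T *ₚ (C +ₚ (Yₚ *ₚ k))) +ₚ (A +ₚ const (x * eval p x))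
      ≈⟨ +ₚ-congʳ (const (a + x * eval p x)) (*ₚ-congˡ T (≋-sym (∷≋const+Yₚ*ₚ _ k))) ⟩
    (T *ₚ (eval p x ∷ k)) +ₚ const (a + x * eval p x) ∎)
    where
    open ≋-Reasoning
    open PolySolver
    A = const a
    C = const (eval p x)
    T = Y- x
    X = const x
    Yₚ≋T+X : Yₚ ≋ (T +ₚ X)
    Yₚ≋T+X = ∷-cong (sym (-‿inverseˡ x)) ≋-refl

  -- Write d = (Y - x) k + d(x); then d(x) P = P d - k (Y - x) P is a multiple of d.
  ∣-cancel-Y- : ∀ {d x c⁻¹ P} → eval d x * c⁻¹ ≈ 1# → d ∣ (Y- x *ₚ P) → d ∣ P
  ∣-cancel-Y- {d} {x} {c⁻¹} {P} cc⁻¹≈1 (s , s*d≋TP) with remainder-theorem d x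
  ... | k , d≋ = CI *ₚ Q , (begin
    (CI *ₚ Q) *ₚ d ≈⟨ *ₚ-assoc CI Q d ⟩
    CI *ₚ (Q *ₚ d) ≈⟨ *ₚ-congˡ CI Q*d≋C*P ⟩
    CI *ₚ (C *ₚ P) ≈⟨ *ₚ-assoc CI C P ⟨
    (CI *ₚ C) *ₚ P ≈⟨ *ₚ-congʳ P CI*C≋1ₚ ⟩
    1ₚ *ₚ P        ≈⟨ *ₚ-identityˡ P ⟩
    P              ∎)
    where
    open ≋-Reasoning
    T  = Y- x
    C  = const (eval d x)
    CI = const c⁻¹
    Q  = P +ₚ -ₚ (k *ₚ s)
    CI*C≋1ₚ : (CI *ₚ C) ≋ 1ₚ
    CI*C≋1ₚ = ≋-trans (≋-sym (const-* c⁻¹ (eval d x))) (∷-cong (trans (*-comm c⁻¹ _) cc⁻¹≈1) ≋-refl)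
    Q*d≋C*P : (Q *ₚ d) ≋ (C *ₚ P)
    Q*d≋C*P = begin
      Q *ₚ d
        ≈⟨ PolyRingProperties.[y-z]x≈yx-zx d P (k *ₚ s) ⟩
      (P *ₚ d) +ₚ -ₚ ((k *ₚ s) *ₚ d)
        ≈⟨ +ₚ-cong (*ₚ-congˡ P d≋) (-ₚ-cong (≋-trans (*ₚ-assoc k s d) (*ₚ-congˡ k s*d≋TP))) ⟩
      (P *ₚ ((T *ₚ k) +ₚ C)) +ₚ -ₚ (k *ₚ (T *ₚ P))
        ≈⟨ +ₚ-congʳ (-ₚ (k *ₚ (T *ₚ P)))
             (solve 4 (λ P T K C → (P :* (T :* K :+ C)) := (K :* (T :* P) :+ C :* P)) ≋-refl P T k C) ⟩
      ((k *ₚ (T *ₚ P)) +ₚ (C *ₚ P)) +ₚ -ₚ (k *ₚ (T *ₚ P))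
        ≈⟨ PolyRingProperties.xyx⁻¹≈y (k *ₚ (T *ₚ P)) (C *ₚ P) ⟩
      C *ₚ P ∎
      where open PolySolver

  record IsIdeal {v} (I : Pol → Set v) : Set (c ⊔ ℓ ⊔ v) where
    field
      resp-≋   : ∀ {p q} → p ≋ q → I p → I q
      +-closed : ∀ {p q} → I p → I q → I (p +ₚ q)
      *-closed : ∀ w {p} → I p → I (w *ₚ p)

    ∣-closed : ∀ {p q} → p ∣ q → I p → I q
    ∣-closed (s , s*p≋q) Ip = resp-≋ s*p≋q (*-closed s Ip)

    cancelˡ : ∀ {p q} → I (p +ₚ q) → I p → I q
    cancelˡ {p} {q} Ip+q Ip = resp-≋ (PolyRingProperties.xyx⁻¹≈y p q)
      (+-closed Ip+q (resp-≋ (PolyRingProperties.-1*x≈-x p) (*-closed (-ₚ 1ₚ) Ip)))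

  MonicCommonDivisorIn : ∀ {v} → (Pol → Set v) → Pol → Pol → Set (c ⊔ ℓ ⊔ v)
  MonicCommonDivisorIn I p q = ∃ λ d → ∃ λ e → Monic d e × d ∣ p × d ∣ q × I d

  -- The formal derivative

  D : Pol → Pol
  D []      = []
  D (a ∷ p) = p +ₚ (0# ∷ D p)

  D-≋[] : ∀ {p} → p ≋ [] → D p ≋ []
  D-≋[] {[]}    e = ≋-refl
  D-≋[] {a ∷ p} e = ≋-trans (+ₚ-cong p≋[] (∷-cong refl (D-≋[] p≋[]))) 0∷[]≋[]
    where p≋[] = ∷≋[]⇒≋[] e

  D-cong : ∀ {p q} → p ≋ q → D p ≋ D q
  D-cong {[]}    {q}     e = ≋-sym (D-≋[] (≋-sym e))
  D-cong {a ∷ p} {[]}    e = D-≋[] e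
  D-cong {a ∷ p} {b ∷ q} e = +ₚ-cong (∷-injectiveʳ e) (∷-cong refl (D-cong (∷-injectiveʳ e)))

  D-+ₚ : ∀ p q → D (p +ₚ q) ≋ (D p +ₚ D q)
  D-+ₚ []      q       = ≋-refl
  D-+ₚ (a ∷ p) []      = ≋-sym (+ₚ-identityʳ _)
  D-+ₚ (a ∷ p) (b ∷ q) = ≋-trans
    (+ₚ-congˡ (p +ₚ q) (≋-trans (∷-cong refl (D-+ₚ p q)) (0∷-+ₚ (D p) (D q))))
    (interchange p q (0# ∷ D p) (0# ∷ D q))

  D-·ₚ : ∀ a p → D (a ·ₚ p) ≋ (a ·ₚ D p)
  D-·ₚ a []      = ≋-refl
  D-·ₚ a (b ∷ p) = ≋-sym (≋-trans (·ₚ-distribˡ a p (0# ∷ D p))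
    (+ₚ-congˡ (a ·ₚ p) (∷-cong (zeroʳ a) (≋-sym (D-·ₚ a p)))))

  D-*ₚ : ∀ p q → D (p *ₚ q) ≋ ((D p *ₚ q) +ₚ (p *ₚ D q))
  D-*ₚ []      q = ≋-refl
  D-*ₚ (a ∷ p) q = begin
    D ((a ·ₚ q) +ₚ (0# ∷ p *ₚ q))
      ≈⟨ D-+ₚ (a ·ₚ q) (0# ∷ p *ₚ q) ⟩
    D (a ·ₚ q) +ₚ ((p *ₚ q) +ₚ (0# ∷ D (p *ₚ q)))
      ≈⟨ +ₚ-cong (D-·ₚ a q) (+ₚ-congˡ (p *ₚ q) (∷-cong refl (D-*ₚ p q))) ⟩
    (a ·ₚ D q) +ₚ ((p *ₚ q) +ₚ (0# ∷ (D p *ₚ q) +ₚ (p *ₚ D q)))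
      ≈⟨ +ₚ-congˡ (a ·ₚ D q) (+ₚ-congˡ (p *ₚ q) (0∷-+ₚ (D p *ₚ q) (p *ₚ D q))) ⟩
    (a ·ₚ D q) +ₚ ((p *ₚ q) +ₚ ((0# ∷ D p *ₚ q) +ₚ (0# ∷ p *ₚ D q)))
      ≈⟨ solve 4 (λ A B C E → (A :+ (B :+ (C :+ E))) := ((B :+ C) :+ (A :+ E))) ≋-refl
               (a ·ₚ D q) (p *ₚ q) (0# ∷ D p *ₚ q) (0# ∷ p *ₚ D q) ⟩
    ((p *ₚ q) +ₚ (0# ∷ D p *ₚ q)) +ₚ ((a ·ₚ D q) +ₚ (0# ∷ p *ₚ D q))
      ≈⟨ +ₚ-congʳ _ (+ₚ-congˡ (p *ₚ q) (0∷-*ₚ (D p) q)) ⟨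
    ((p *ₚ q) +ₚ ((0# ∷ D p) *ₚ q)) +ₚ ((a ·ₚ D q) +ₚ (0# ∷ p *ₚ D q))
      ≈⟨ +ₚ-congʳ _ (*ₚ-distribʳ q p (0# ∷ D p)) ⟨
    ((p +ₚ (0# ∷ D p)) *ₚ q) +ₚ ((a ·ₚ D q) +ₚ (0# ∷ p *ₚ D q)) ∎
    where
    open ≋-Reasoning
    open PolySolver

  Deg<-D : ∀ {p k} → Deg< p (suc k) → Deg< (D p) k
  Deg<-D {p} {k} d = mkDeg< (go p k d)
    where
    go : ∀ p k → Deg< p (suc k) → ∀ i → k ≤ i → coeff (D p) i ≈ 0#
    go []      k       d i       le       = refl
    go (a ∷ p) zero    d i       le       =
      at (≋-trans (+ₚ-cong p≋[] (∷-cong refl (D-≋[] p≋[]))) 0∷[]≋[]) i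
      where p≋[] = Deg<0⇒≋[] (Deg<-∷ d)
    go (a ∷ p) (suc k) d (suc i) (s≤s le) = trans (coeff-+ₚ p (0# ∷ D p) (suc i))
      (trans (+-cong (vanish d (suc (suc i)) (s≤s (s≤s le))) (go p k (Deg<-∷ d) i le)) (+-identityʳ 0#))

  double-root : ∀ {p} b q → p ≋ ((Y- b *ₚ Y- b) *ₚ q) → eval p b ≈ 0# × eval (D p) b ≈ 0#
  double-root {p} b q p≋ = p[b]≈0 , p′[b]≈0
    where
    r = Y- b *ₚ q
    p≋Y-b*r : p ≋ (Y- b *ₚ r)
    p≋Y-b*r = ≋-trans p≋ (*ₚ-assoc (Y- b) (Y- b) q)
    p[b]≈0 : eval p b ≈ 0#
    p[b]≈0 = trans (eval-cong b p≋Y-b*r) (eval-Y-*ₚ[self] b r)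
    p′[b]≈0 : eval (D p) b ≈ 0#
    p′[b]≈0 = begin
      eval (D p) b
        ≈⟨ eval-cong b (≋-trans (D-cong p≋Y-b*r) (D-*ₚ (Y- b) r)) ⟩
      eval ((D (Y- b) *ₚ r) +ₚ (Y- b *ₚ D r)) b
        ≈⟨ eval-+ₚ (D (Y- b) *ₚ r) (Y- b *ₚ D r) b ⟩
      eval (D (Y- b) *ₚ r) b + eval (Y- b *ₚ D r) b
        ≈⟨ +-cong (eval-*ₚ (D (Y- b)) r b) (eval-Y-*ₚ[self] b (D r)) ⟩
      eval (D (Y- b)) b * eval r b + 0#
        ≈⟨ +-congʳ (*-congˡ (eval-Y-*ₚ[self] b q)) ⟩
      eval (D (Y- b)) b * 0# + 0#
        ≈⟨ trans (+-identityʳ _) (zeroʳ _) ⟩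
      0# ∎
      where open SetoidReasoning setoid

  -- Taylor shift and the twisted derivative

  shift-∷ : ∀ a p x → shift (a ∷ p) x ≋ (const a +ₚ ((x ·ₚ shift p x) +ₚ (0# ∷ shift p x)))
  shift-∷ a p x = +ₚ-congˡ (const a) (+ₚ-congˡ (x ·ₚ shift p x) (∷-cong refl (*ₚ-identityˡ (shift p x))))

  coeff-shift-∷-suc : ∀ a p x j →
    coeff (shift (a ∷ p) x) (suc j) ≈ x * coeff (shift p x) (suc j) + coeff (shift p x) j
  coeff-shift-∷-suc a p x j = trans (at (shift-∷ a p x) (suc j))
    (trans (coeff-+ₚ (const a) ((x ·ₚ S) +ₚ (0# ∷ S)) (suc j))
    (trans (+-identityˡ _) (trans (coeff-+ₚ (x ·ₚ S) (0# ∷ S) (suc j)) (+-congʳ (coeff-·ₚ x S (suc j))))))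
    where S = shift p x

  coeff-shift-zero : ∀ p x → coeff (shift p x) 0 ≈ eval p x
  coeff-shift-zero []      x = refl
  coeff-shift-zero (a ∷ p) x = begin
    coeff (shift (a ∷ p) x) 0                      ≈⟨ at (shift-∷ a p x) 0 ⟩
    coeff (const a +ₚ ((x ·ₚ S) +ₚ (0# ∷ S))) 0   ≈⟨ coeff-+ₚ (const a) ((x ·ₚ S) +ₚ (0# ∷ S)) 0 ⟩
    a + coeff ((x ·ₚ S) +ₚ (0# ∷ S)) 0            ≈⟨ +-congˡ (coeff-+ₚ (x ·ₚ S) (0# ∷ S) 0) ⟩
    a + (coeff (x ·ₚ S) 0 + 0#)                   ≈⟨ +-congˡ (trans (+-identityʳ _) (coeff-·ₚ x S 0)) ⟩
    a + x * coeff S 0                             ≈⟨ +-congˡ (*-congˡ (coeff-shift-zero p x)) ⟩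
    a + x * eval p x                              ∎
    where
    open SetoidReasoning setoid
    S = shift p x

  coeff-shift-one : ∀ p x → coeff (shift p x) 1 ≈ eval (D p) x
  coeff-shift-one []      x = refl
  coeff-shift-one (a ∷ p) x = begin
    coeff (shift (a ∷ p) x) 1                     ≈⟨ coeff-shift-∷-suc a p x 0 ⟩
    x * coeff (shift p x) 1 + coeff (shift p x) 0 ≈⟨ +-cong (*-congˡ (coeff-shift-one p x)) (coeff-shift-zero p x) ⟩
    x * eval (D p) x + eval p x                   ≈⟨ +-comm _ _ ⟩
    eval p x + x * eval (D p) x                   ≈⟨ +-congˡ (+-identityˡ _) ⟨
    eval p x + (0# + x * eval (D p) x)            ≈⟨ eval-+ₚ p (0# ∷ D p) x ⟨
    eval (D (a ∷ p)) x                            ∎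
    where open SetoidReasoning setoid

  shift-≋[] : ∀ {p} x → p ≋ [] → shift p x ≋ []
  shift-≋[] {[]}    x e = ≋-refl
  shift-≋[] {a ∷ p} x e = ≋-trans (shift-∷ a p x)
    (+ₚ-cong (≋-trans (∷-cong (at e 0) ≋-refl) 0∷[]≋[])
             (+ₚ-cong (·ₚ-cong refl S≋[]) (≋-trans (∷-cong refl S≋[]) 0∷[]≋[])))
    where S≋[] = shift-≋[] x (∷≋[]⇒≋[] e)

  Deg<-shift : ∀ {p k} x → Deg< p k → Deg< (shift p x) k
  Deg<-shift {p} {k} x d = mkDeg< (go p k d)
    where
    go : ∀ p k → Deg< p k → ∀ i → k ≤ i → coeff (shift p x) i ≈ 0#
    go []      k       d i       le       = refl
    go (a ∷ p) zero    d i       le       = at (shift-≋[] x (Deg<0⇒≋[] d)) i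
    go (a ∷ p) (suc k) d (suc i) (s≤s le) = trans (coeff-shift-∷-suc a p x i)
      (trans (+-cong (trans (*-congˡ (go p k (Deg<-∷ d) (suc i) (ℕ.m≤n⇒m≤1+n le))) (zeroʳ x))
                     (go p k (Deg<-∷ d) i le))
             (+-identityʳ 0#))

  Monic-shift : ∀ {p e} x → Monic p e → Monic (shift p x) e
  Monic-shift {p} {e} x (top , d) = go p e top d , Deg<-shift x d
    where
    go : ∀ p e → coeff p e ≈ 1# → Deg< p (suc e) → coeff (shift p x) e ≈ 1#
    go []      e       top d = top
    go (a ∷ p) zero    top d = begin
      coeff (shift (a ∷ p) x) 0 ≈⟨ coeff-shift-zero (a ∷ p) x ⟩
      a + x * eval p x          ≈⟨ +-congˡ (trans (*-congˡ (eval-≋[] x (Deg<0⇒≋[] (Deg<-∷ d)))) (zeroʳ x)) ⟩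
      a + 0#                    ≈⟨ +-identityʳ a ⟩
      a                         ≈⟨ top ⟩
      1#                        ∎
      where open SetoidReasoning setoid
    go (a ∷ p) (suc e) top d = begin
      coeff (shift (a ∷ p) x) (suc e)
        ≈⟨ coeff-shift-∷-suc a p x e ⟩
      x * coeff (shift p x) (suc e) + coeff (shift p x) e
        ≈⟨ +-cong (*-congˡ (vanish (Deg<-shift x (Deg<-∷ d)) (suc e) ℕ.≤-refl)) (go p e top (Deg<-∷ d)) ⟩
      x * 0# + 1#
        ≈⟨ trans (+-congʳ (zeroʳ x)) (+-identityˡ 1#) ⟩
      1# ∎
      where open SetoidReasoning setoid

  Monic-drop : ∀ k {p e} → Monic p (k ℕ.+ e) → Monic (drop k p) e
  Monic-drop zero    monic-p           = monic-p
  Monic-drop (suc k) {[]}    (top , d) = top , mkDeg< λ _ _ → refl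
  Monic-drop (suc k) {a ∷ p} (top , d) = Monic-drop k (top , Deg<-∷ d)

  Monic-Yₚ : Monic Yₚ 1
  Monic-Yₚ = refl , mkDeg< λ { (suc (suc i)) _ → refl ; (suc zero) (s≤s ()) }

  drop1≋Yₚ*ₚdrop2 : ∀ p → coeff p 1 ≈ 0# → drop 1 p ≋ (Yₚ *ₚ drop 2 p)
  drop1≋Yₚ*ₚdrop2 p p₁≈0 = ≋-trans (go p p₁≈0) (≋-sym (Yₚ*ₚ (drop 2 p)))
    where
    go : ∀ p → coeff p 1 ≈ 0# → drop 1 p ≋ (0# ∷ drop 2 p)
    go []          _   = ≋-sym 0∷[]≋[]
    go (a ∷ [])    _   = ≋-sym 0∷[]≋[]
    go (a ∷ b ∷ p) b≈0 = ∷-cong b≈0 ≋-refl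

  twistedDeriv≡drop1∘shift : ∀ θ β → twistedDeriv θ β ≡ drop 1 (shift θ β)
  twistedDeriv≡drop1∘shift θ β with shift θ β
  ... | []    = ≡.refl
  ... | _ ∷ _ = ≡.refl

  -- θ(Y + β) = θ(β) + θ′(β) Y + …, so the twisted derivative has constant term θ′(β).
  twistedDeriv≋Yₚ*ₚ : ∀ θ β → eval (D θ) β ≈ 0# → twistedDeriv θ β ≋ (Yₚ *ₚ drop 2 (shift θ β))
  twistedDeriv≋Yₚ*ₚ θ β θ′β≈0 rewrite twistedDeriv≡drop1∘shift θ β =
    drop1≋Yₚ*ₚdrop2 (shift θ β) (trans (coeff-shift-one θ β) θ′β≈0)

  record IsSubsemiring {ℓₛ} (F : Carrier → Set ℓₛ) : Set (c ⊔ ℓ ⊔ ℓₛ) where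
    field
      0#∈      : F 0#
      1#∈      : F 1#
      +-closed : ∀ {x y} → F x → F y → F (x + y)
      *-closed : ∀ {x y} → F x → F y → F (x * y)

  module _ {ℓₛ} {F : Carrier → Set ℓₛ} (F-sub : IsSubsemiring F) where
    open IsSubsemiring F-sub

    InSub-+ₚ : ∀ {p q} → InSub F p → InSub F q → InSub F (p +ₚ q)
    InSub-+ₚ []         Fq         = Fq
    InSub-+ₚ (Fa ∷ Fp)  []         = Fa ∷ Fp
    InSub-+ₚ (Fa ∷ Fp)  (Fb ∷ Fq)  = +-closed Fa Fb ∷ InSub-+ₚ Fp Fq

    InSub-*ₚ : ∀ {p q} → InSub F p → InSub F q → InSub F (p *ₚ q)
    InSub-*ₚ []        Fq = []
    InSub-*ₚ (Fa ∷ Fp) Fq = InSub-+ₚ (All.map⁺ (All.map (*-closed Fa) Fq)) (0#∈ ∷ InSub-*ₚ Fp Fq)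

    InSub-shift : ∀ {p x} → F x → InSub F p → InSub F (shift p x)
    InSub-shift Fx []        = []
    InSub-shift Fx (Fa ∷ Fp) = InSub-+ₚ (Fa ∷ []) (InSub-*ₚ (Fx ∷ 1#∈ ∷ []) (InSub-shift Fx Fp))

    InSub-Yₚ : InSub F Yₚ
    InSub-Yₚ = 0#∈ ∷ 1#∈ ∷ []

  twistedDeriv-¬irreducible : ¬ 0# ≈ 1# → ∀ {ℓₛ} {F : Carrier → Set ℓₛ} → IsSubsemiring F →
    ∀ {θ m β} → Monic θ (suc (suc (suc m))) → InSub F θ → F β → eval (D θ) β ≈ 0# →
    ¬ IrreducibleIn F (twistedDeriv θ β)
  twistedDeriv-¬irreducible 0≉1 {F = F} F-sub {θ} {m} {β} monic-θ Fθ Fβ θ′β≈0 (_ , _ , factors)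
    with factors Yₚ H (InSub-Yₚ F-sub) FH (at (twistedDeriv≋Yₚ*ₚ θ β θ′β≈0))
    where
    H : Pol
    H = drop 2 (shift θ β)
    FH : InSub F H
    FH = All.drop⁺ 2 (InSub-shift F-sub Fβ Fθ)
  ... | inj₁ (b , _ , Yₚb≈1) = Monic⇒¬unit 0≉1 {s = b} Monic-Yₚ (mk≋ Yₚb≈1)
  ... | inj₂ (b , _ , Hb≈1)  = Monic⇒¬unit 0≉1 {s = b} (Monic-drop 2 (Monic-shift β monic-θ)) (mk≋ Hb≈1)

module PolynomialMap {c ℓ c′ ℓ′} (R : CommutativeRing c ℓ) (S : CommutativeRing c′ ℓ′)
  {φ : CommutativeRing.Carrier R → CommutativeRing.Carrier S}
  (φ-hom : IsSemiringHomomorphism (Semiring.rawSemiring (CommutativeRing.semiring R))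
                                 (Semiring.rawSemiring (CommutativeRing.semiring S)) φ) where

  private
    module R[Y] = Polynomials R
    module S[Y] = Polynomials S
  open R[Y] using (_,_)
  open CommutativeRing S hiding (zero)
  open IsSemiringHomomorphism φ-hom

  coeff-map : ∀ p i → S[Y].coeff (map φ p) i ≈ φ (R[Y].coeff p i)
  coeff-map []      i       = sym 0#-homo
  coeff-map (a ∷ p) zero    = refl
  coeff-map (a ∷ p) (suc i) = coeff-map p i

  map-cong : ∀ {p q} → p R[Y].≋ q → map φ p S[Y].≋ map φ q
  map-cong {p} {q} p≋q = S[Y].mk≋ λ i →
    trans (coeff-map p i) (trans (⟦⟧-cong (R[Y].at p≋q i)) (sym (coeff-map q i)))

  map-+ₚ : ∀ p q → map φ (p R[Y].+ₚ q) S[Y].≋ (map φ p S[Y].+ₚ map φ q)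
  map-+ₚ p q = S[Y].mk≋ λ i → trans (coeff-map (p R[Y].+ₚ q) i)
    (trans (⟦⟧-cong (R[Y].coeff-+ₚ p q i)) (trans (+-homo _ _)
      (sym (trans (S[Y].coeff-+ₚ (map φ p) (map φ q) i) (+-cong (coeff-map p i) (coeff-map q i))))))

  map-·ₚ : ∀ a p → map φ (a R[Y].·ₚ p) S[Y].≋ (φ a S[Y].·ₚ map φ p)
  map-·ₚ a p = S[Y].mk≋ λ i → trans (coeff-map (a R[Y].·ₚ p) i)
    (trans (⟦⟧-cong (R[Y].coeff-·ₚ a p i)) (trans (*-homo _ _)
      (sym (trans (S[Y].coeff-·ₚ (φ a) (map φ p) i) (*-congˡ (coeff-map p i))))))

  map-*ₚ : ∀ p q → map φ (p R[Y].*ₚ q) S[Y].≋ (map φ p S[Y].*ₚ map φ q)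
  map-*ₚ []      q = S[Y].≋-refl
  map-*ₚ (a ∷ p) q = S[Y].≋-trans (map-+ₚ (a R[Y].·ₚ q) _)
    (S[Y].+ₚ-cong (map-·ₚ a q) (S[Y].∷-cong 0#-homo (map-*ₚ p q)))

  map-D : ∀ p → map φ (R[Y].D p) S[Y].≋ S[Y].D (map φ p)
  map-D []      = S[Y].≋-refl
  map-D (a ∷ p) = S[Y].≋-trans (map-+ₚ p _) (S[Y].+ₚ-congˡ (map φ p) (S[Y].∷-cong 0#-homo (map-D p)))

  map-∣ : ∀ {d p} → d R[Y].∣ p → map φ d S[Y].∣ map φ p
  map-∣ {d} (s , s*d≋p) =
    S[Y].xy≈z⇒y∣ʳz (map φ s) (map φ d) (S[Y].≋-trans (S[Y].≋-sym (map-*ₚ s d)) (map-cong s*d≋p))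

  map-Monic : ∀ {p e} → R[Y].Monic p e → S[Y].Monic (map φ p) e
  map-Monic {p} {e} (top , d) =
    trans (coeff-map p e) (trans (⟦⟧-cong top) 1#-homo) ,
    S[Y].mkDeg< λ i le → trans (coeff-map p i) (trans (⟦⟧-cong (R[Y].vanish d i le)) 0#-homo)

  eval-map-kernel-isIdeal : ∀ β → R[Y].IsIdeal (λ p → S[Y].eval (map φ p) β ≈ 0#)
  eval-map-kernel-isIdeal β = record
    { resp-≋   = λ p≋q p[β]≈0 → trans (S[Y].eval-cong β (map-cong (R[Y].≋-sym p≋q))) p[β]≈0
    ; +-closed = λ {p} {q} p[β]≈0 q[β]≈0 → trans (S[Y].eval-cong β (map-+ₚ p q))
        (trans (S[Y].eval-+ₚ (map φ p) (map φ q) β) (trans (+-cong p[β]≈0 q[β]≈0) (+-identityʳ 0#)))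
    ; *-closed = λ w {p} p[β]≈0 → trans (S[Y].eval-cong β (map-*ₚ w p))
        (trans (S[Y].eval-*ₚ (map φ w) (map φ p) β) (trans (*-congˡ p[β]≈0) (zeroʳ _)))
    }

Embedding-isSemiringHomomorphism : ∀ {c ℓ c′ ℓ′} {K : Field c ℓ} {L : Field c′ ℓ′} (ι : Embedding K L) →
  IsSemiringHomomorphism (Semiring.rawSemiring (Field.semiring K)) (Semiring.rawSemiring (Field.semiring L))
                         (Embedding.⟦_⟧ ι)
Embedding-isSemiringHomomorphism ι = record
  { isNearSemiringHomomorphism = record
    { +-isMonoidHomomorphism = record
      { isMagmaHomomorphism = record
        { isRelHomomorphism = record { cong = cong }
        ; homo              = +-hom }
      ; ε-homo = 0-hom }
    ; *-homo = *-hom }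
  ; 1#-homo = 1-hom }
  where open Embedding ι

-- Polynomials over a field

module FieldPolynomials {c ℓ} (K : Field c ℓ) where
  open Field K hiding (zero; inverse)
  open Polynomials commutativeRing

  monic-associate : ∀ q k → Deg< q k →
    ¬ ¬ (q ≋ [] ⊎ ∃ λ e → ∃ λ m → e < k × Monic m e × m ∥ q)
  monic-associate q zero    q<0 ¬goal = ¬goal (inj₁ (Deg<0⇒≋[] q<0))
  monic-associate q (suc k) q<  ¬goal = ¬¬-excluded-middle λ
    { (yes qₖ≈0) → monic-associate q k (Deg<-shrink q< qₖ≈0) λ
        { (inj₁ q≋[])                  → ¬goal (inj₁ q≋[])
        ; (inj₂ (e , m , e<k , rest)) → ¬goal (inj₂ (e , m , ℕ.m<n⇒m<1+n e<k , rest)) }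
    ; (no qₖ≉0) → let (y , qₖy≈1) = Field.inverse K (coeff q k) qₖ≉0 in
        ¬goal (inj₂ (k , y ·ₚ q , ℕ.n<1+n k , Monic-scaled y qₖy≈1 , ·ₚ-∥ q qₖy≈1)) }
    where
    Monic-scaled : ∀ y → coeff q k * y ≈ 1# → Monic (y ·ₚ q) k
    Monic-scaled y qₖy≈1 =
      trans (coeff-·ₚ y q k) (trans (*-comm y _) qₖy≈1) ,
      mkDeg< λ i le → trans (coeff-·ₚ y q i) (trans (*-congˡ (vanish q< i le)) (zeroʳ y))

  gcd-in-ideal : ∀ {v} {I : Pol → Set v} → IsIdeal I →
                 ∀ {p q e} → Monic p e → Deg< q e → I p → I q → ¬ ¬ MonicCommonDivisorIn I p q
  gcd-in-ideal {I = I} I-ideal {e = e} = go (suc e) ℕ.≤-refl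
    where
    open IsIdeal I-ideal
    go : ∀ fuel {p q e} → e < fuel → Monic p e → Deg< q e → I p → I q → ¬ ¬ MonicCommonDivisorIn I p q
    go (suc fuel) {p} {q} {e} e<fuel monic-p q< Ip Iq ¬gcd = monic-associate q e q< λ
      { (inj₁ q≋[]) → ¬gcd (p , e , monic-p , ∣ʳ-refl , ([] , ≋-sym q≋[]) , Ip)
      ; (inj₂ (e₁ , m , e₁<e , monic-m , m∣q , q∣m)) →
          let (w , r , p≋wm+r , r<) = divide-by-monic (suc e) (proj₂ monic-p) monic-m
              Im = ∣-closed q∣m Iq
              Ir = cancelˡ (resp-≋ p≋wm+r Ip) (*-closed w Im)
          in go fuel (ℕ.<-≤-trans e₁<e (ℕ.≤-pred e<fuel)) monic-m r< Im Ir
               λ (d , e′ , monic-d , d∣m , d∣r , Id) →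
                 let d∣p = ∣ʳ-respʳ-≈ (≋-sym p≋wm+r) (∣-+ₚ (x∣ʳy⇒x∣ʳzy w d∣m) d∣r)
                 in ¬gcd (d , e′ , monic-d , d∣p , ∣ʳ-trans d∣m m∣q , Id) }

  prodLin-divisor-has-root : ∀ n r {d e} → Monic d (suc e) → d ∣ prodLin n r →
                             ¬ ¬ (∃ λ i → eval d (r i) ≈ 0#)
  prodLin-divisor-has-root zero    r {d} monic-d (s , s*d≋1) _ =
    Monic⇒¬unit 0≉1 monic-d (≋-trans (*ₚ-comm d s) s*d≋1)
  prodLin-divisor-has-root (suc n) r monic-d d∣ ¬root = ¬¬-excluded-middle λ
    { (yes d[r₀]≈0) → ¬root (Fin.zero , d[r₀]≈0)
    ; (no  d[r₀]≉0) → let (c⁻¹ , cc⁻¹≈1) = Field.inverse K _ d[r₀]≉0 in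
        prodLin-divisor-has-root n (r ∘ Fin.suc) monic-d (∣-cancel-Y- cc⁻¹≈1 d∣)
          λ (i , d[rᵢ]≈0) → ¬root (Fin.suc i , d[rᵢ]≈0) }

module EmbeddingMap {c ℓ c′ ℓ′} {K : Field c ℓ} {L : Field c′ ℓ′} (ι : Embedding K L) =
  PolynomialMap (Field.commutativeRing K) (Field.commutativeRing L) (Embedding-isSemiringHomomorphism ι)

Monic-monic : ∀ {c ℓ} (K : Field c ℓ) n a → Polynomials.Monic (Field.commutativeRing K) (monic K n a) n
Monic-monic K zero    a = Field.refl K , Polynomials.mkDeg< λ { (suc i) _ → Field.refl K }
Monic-monic K (suc n) a with Monic-monic K n (a ∘ Fin.suc)
... | top , d< = top , Polynomials.mkDeg< λ { (suc i) (s≤s le) → Polynomials.vanish d< i le }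

Adjoin-isSubsemiring : ∀ {c ℓ c′ ℓ′ ℓₛ} {K : Field c ℓ} {L : Field c′ ℓ′} (ι : Embedding K L)
                       {S : Field.Carrier L → Set ℓₛ} →
                       Polynomials.IsSubsemiring (Field.commutativeRing L) (Adjoin ι S)
Adjoin-isSubsemiring {K = K} ι = record
  { 0#∈      = resp (base (Field.0# K)) 0-hom
  ; 1#∈      = resp (base (Field.1# K)) 1-hom
  ; +-closed = add
  ; *-closed = mul
  }
  where open Embedding ι

module _ {c ℓ c′ ℓ′ c″ ℓ″} {K : Field c ℓ} {L : Field c′ ℓ′} {M : Field c″ ℓ″}
         (ι : Embedding K L) (j : Embedding K M) where
  private
    module K[Y] = Polynomials (Field.commutativeRing K)
    module L[Y] = Polynomials (Field.commutativeRing L)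
    module M[Y] = Polynomials (Field.commutativeRing M)
    module ι[Y] = EmbeddingMap ι
    module j[Y] = EmbeddingMap j
    module L = Field L
    module M = Field M

  common-root-transfer : ∀ {p q e n} (r : Fin n → L.Carrier) →
    K[Y].Monic p e → K[Y].Deg< q e → mapPol ι p L[Y].≋ L[Y].prodLin n r →
    ∀ β → M[Y].eval (mapPol j p) β M.≈ M.0# → M[Y].eval (mapPol j q) β M.≈ M.0# →
    ¬ ¬ (∃ λ i → L[Y].eval (mapPol ι q) (r i) L.≈ L.0#)
  common-root-transfer r monic-p q< p≋∏ β p[β]≈0 q[β]≈0 ¬root =
    FieldPolynomials.gcd-in-ideal K (j[Y].eval-map-kernel-isIdeal β) monic-p q< p[β]≈0 q[β]≈0 λ
      { (d , zero , monic-d , _ , _ , d[β]≈0) → M.0≉1 (M.sym (begin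
          M.1#                              ≈⟨ Embedding.1-hom j ⟨
          Embedding.⟦ j ⟧ (Field.1# K)       ≈⟨ M[Y].eval-const _ β ⟨
          M[Y].eval (mapPol j K[Y].1ₚ) β    ≈⟨ M[Y].eval-cong β (j[Y].map-cong (K[Y].Monic⇒≋1ₚ monic-d)) ⟨
          M[Y].eval (mapPol j d) β          ≈⟨ d[β]≈0 ⟩
          M.0#                              ∎))
      ; (d , suc e′ , monic-d , d∣p , d∣q , _) →
          FieldPolynomials.prodLin-divisor-has-root L _ r (ι[Y].map-Monic monic-d)
            (L[Y].∣ʳ-respʳ-≈ p≋∏ (ι[Y].map-∣ d∣p))
            λ (i , d[rᵢ]≈0) → ¬root (i , L[Y].∣-preserves-root (ι[Y].map-∣ d∣q) d[rᵢ]≈0) }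
    where open SetoidReasoning M.setoid

mainTheorem13 :
  ∀ {c ℓ c' ℓ'} (K : Field c ℓ) (n : ℕ) (a : Fin n → Field.Carrier K) →
    n > 2 →
    (L : Field c' ℓ') (ι : Embedding K L) →
    IsSplittingField K L ι (monic K n a) n →
    (∀ (α : Field.Carrier L) →
       Field._≈_ L (Poly.eval (Field.commutativeRing L) (mapPol ι (monic K n a)) α) (Field.0# L) →
       Poly.IrreducibleIn (Field.commutativeRing L) (Adjoin ι (λ x → Field._≈_ L x α))
         (Poly.twistedDeriv (Field.commutativeRing L) (mapPol ι (monic K n a)) α)) →
    ∀ {c'' ℓ''} (M : Field c'' ℓ'') (j : Embedding K M) →
      ¬ HasMultipleRoot M j (monic K n a)
mainTheorem13 K n@(suc (suc (suc _))) a (s≤s (s≤s (s≤s _))) L ι splitting irreducible M j (β , q , f≋) =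
  common-root-transfer ι j roots monic-f (K[Y].Deg<-D (proj₂ monic-f)) f≋∏ β f[β]≈0 f′[β]≈0
    λ (i , f′[rᵢ]≈0) →
      L[Y].twistedDeriv-¬irreducible L.0≉1 (Adjoin-isSubsemiring ι) (ι[Y].map-Monic monic-f)
        (f∈K[α][Y] (roots i)) (gen L.refl)
        (L.trans (L[Y].eval-cong (roots i) (L[Y].≋-sym (ι[Y].map-D f))) f′[rᵢ]≈0)
        (irreducible (roots i) (f[rᵢ]≈0 i))
  where
  module K[Y] = Polynomials (Field.commutativeRing K)
  module L[Y] = Polynomials (Field.commutativeRing L)
  module M[Y] = Polynomials (Field.commutativeRing M)
  module ι[Y] = EmbeddingMap ι
  module j[Y] = EmbeddingMap j
  module L = Field L
  module M = Field M
  open IsSplittingField splitting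

  f : K[Y].Pol
  f = monic K n a

  monic-f : K[Y].Monic f n
  monic-f = Monic-monic K n a

  f∈K[α][Y] : ∀ α → L[Y].InSub (Adjoin ι (λ x → x L.≈ α)) (mapPol ι f)
  f∈K[α][Y] α = All.map⁺ (All.universal base f)

  f≋∏ : mapPol ι f L[Y].≋ L[Y].prodLin n roots
  f≋∏ = L[Y].mk≋ splits

  f[rᵢ]≈0 : ∀ i → L[Y].eval (mapPol ι f) (roots i) L.≈ L.0#
  f[rᵢ]≈0 i = L.trans (L[Y].eval-cong (roots i) f≋∏) (L[Y].eval-prodLin-root n roots i)

  β-is-double : M[Y].eval (mapPol j f) β M.≈ M.0# × M[Y].eval (M[Y].D (mapPol j f)) β M.≈ M.0#
  β-is-double = M[Y].double-root {mapPol j f} β q (M[Y].mk≋ f≋)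

  f[β]≈0 : M[Y].eval (mapPol j f) β M.≈ M.0#
  f[β]≈0 = proj₁ β-is-double

  f′[β]≈0 : M[Y].eval (mapPol j (K[Y].D f)) β M.≈ M.0#
  f′[β]≈0 = M.trans (M[Y].eval-cong β (j[Y].map-D f)) (proj₂ β-is-double)
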